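{- Let $G$ be a graph, $\mathcal{P}$ a maximal $P_2$-packing of $G$ of size $j$, and suppose $G$ has a $P_2$-packing of size $j+1$. If $\mathcal{Q}\in\mathfrak{Q}_{(1)}$, then for every $p\in\mathcal{P}$ with $p\notin\mathcal{Q}$ there are two distinct paths $q_1,q_2\in\mathcal{Q}$ with $|V(p)\cap V(q_i)|\ge 1$ for $i=1,2$.
   Context: A $P_2$ is a path with three vertices and two edges; a $P_2$-packing is a set of pairwise vertex-disjoint $P_2$'s in $G$, maximal if no further $P_2$ vertex-disjoint from all members can be added. For a path $p$, $V(p)$, $E(p)$ denote its vertex and edge sets; for a set of paths, $V(\cdot)$ is the union. $p\notin\mathcal{Q}$ means no $q\in\mathcal{Q}$ has $E(q)=E(p)$. $\mathfrak{Q}_{(1)}$ is the set of all $P_2$-packings $\mathcal{Q}$ of $G$ of size $j+1$ that maximize $\sum_{p\in\mathcal{P}}\sum_{q\in\mathcal{Q}}1_{[E(p)=E(q)]}$ (the number of paths of $\mathcal{P}$ reused in $\mathcal{Q}$). -}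

module Defs where

open import Data.Nat using (ℕ; zero; suc; _≤_)
open import Data.Fin using (Fin)
open import Data.Fin.Properties using (_≟_)
open import Data.List using (List; []; _∷_; length; map)
open import Data.Nat.ListAction using (sum)
open import Data.List.Relation.Unary.All using (All)
open import Data.List.Relation.Unary.Any using (Any)
open import Data.List.Relation.Unary.AllPairs using (AllPairs)
open import Data.Product using (_×_; _,_; proj₁; proj₂)
open import Data.Sum using (_⊎_)
open import Data.Bool using (if_then_else_)
open import Relation.Nullary using (¬_; Dec; does)
open import Relation.Nullary.Decidable using (_×-dec_; _⊎-dec_)
open import Relation.Binary.PropositionalEquality using (_≡_)

record Graph : Set₁ where
  field
    n      : ℕ
    Adj    : Fin n → Fin n → Set
    adj?   : ∀ u v → Dec (Adj u v)
    sym    : ∀ {u v} → Adj u v → Adj v u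
    irrefl : ∀ {u} → ¬ Adj u u

module _ (G : Graph) where
  open Graph G

  Vertex : Set
  Vertex = Fin n

  record P2 : Set where
    constructor path
    field
      a b c : Vertex
      ab    : Adj a b
      bc    : Adj b c
      a≢c   : ¬ (a ≡ c)
  open P2 public

  _∈V_ : Vertex → P2 → Set
  v ∈V p = (v ≡ a p) ⊎ (v ≡ b p) ⊎ (v ≡ c p)

  Meet : P2 → P2 → Set
  Meet p q = Any (λ v → v ∈V q) (a p ∷ b p ∷ c p ∷ [])

  VDisjoint : P2 → P2 → Set
  VDisjoint p q = ¬ Meet p q

  IsPacking : List P2 → Set
  IsPacking = AllPairs VDisjoint

  IsMaximalPacking : List P2 → Set
  IsMaximalPacking 𝒫 = IsPacking 𝒫 × (∀ (p : P2) → ¬ All (VDisjoint p) 𝒫)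

  -- edges as unordered pairs of vertices
  Edge : Set
  Edge = Vertex × Vertex

  SameEdge : Edge → Edge → Set
  SameEdge (u , v) (x , y) = ((u ≡ x) × (v ≡ y)) ⊎ ((u ≡ y) × (v ≡ x))

  sameEdge? : ∀ e f → Dec (SameEdge e f)
  sameEdge? (u , v) (x , y) = ((u ≟ x) ×-dec (v ≟ y)) ⊎-dec ((u ≟ y) ×-dec (v ≟ x))

  E : P2 → List Edge
  E p = (a p , b p) ∷ (b p , c p) ∷ []

  SameEdgeSet : P2 → P2 → Set
  SameEdgeSet p q = All (λ e → Any (SameEdge e) (E q)) (E p)
                  × All (λ e → Any (SameEdge e) (E p)) (E q)

  sameEdgeSet? : ∀ p q → Dec (SameEdgeSet p q)
  sameEdgeSet? p q =
    Data.List.Relation.Unary.All.all? (λ e → Data.List.Relation.Unary.Any.any? (sameEdge? e) (E q)) (E p)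
    ×-dec Data.List.Relation.Unary.All.all? (λ e → Data.List.Relation.Unary.Any.any? (sameEdge? e) (E p)) (E q)

  -- p ∉ 𝒬 : no q ∈ 𝒬 with E(q) = E(p)
  NotIn : P2 → List P2 → Set
  NotIn p 𝒬 = ¬ Any (SameEdgeSet p) 𝒬

  reuse : List P2 → List P2 → ℕ
  reuse 𝒫 𝒬 = sum (map (λ p → sum (map (λ q → if does (sameEdgeSet? p q) then 1 else 0) 𝒬)) 𝒫)

  -- 𝒬 ∈ 𝔔₍₁₎ (relative to 𝒫 and j): a packing of size j+1 maximizing reuse
  InQ1 : List P2 → ℕ → List P2 → Set
  InQ1 𝒫 j 𝒬 = IsPacking 𝒬 × (length 𝒬 ≡ suc j)
              × (∀ 𝒬' → IsPacking 𝒬' → length 𝒬' ≡ suc j → reuse 𝒫 𝒬' ≤ reuse 𝒫 𝒬)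

-- If p ∈ 𝒫 is not in 𝒬, then at
-- least two members of 𝒬 meet p.
--
-- Idea: suppose at most one member of 𝒬 meets p.  We find a member q of 𝒬
-- that is not reused from 𝒫 and such that p is disjoint from the rest of 𝒬.
-- Exchanging q for p then gives a packing of the same size with strictly
-- larger reuse (p is reused, q was not), contradicting optimality.
--   * If no member of 𝒬 meets p, take any unreused q: one exists because
--     each path of 𝒫 is reused by at most one member of the packing 𝒬
--     (double counting), so at most |𝒫| = j < j+1 = |𝒬| members are reused.
--   * If exactly one q meets p, then q itself is unreused: a path p' ∈ 𝒫
--     with the edges of q would meet p, hence equal p, putting p in 𝒬.
module Submission where

open import Defs
open import Data.Nat using (ℕ; suc; _+_; _≤_; _<_; z≤n; s≤s)
open import Data.Nat.Properties
  using (≤-trans; ≤-reflexive; +-mono-≤; +-monoˡ-≤; m≤m+n; m≤n+m; <⇒≱; n≢0⇒n>0; _≟_; +-commutativeSemigroup; module ≤-Reasoning)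
open import Algebra.Properties.CommutativeSemigroup +-commutativeSemigroup using (interchange)
open import Data.Nat.ListAction using (sum)
open import Data.Nat.ListAction.Properties using (sum-↭)
open import Data.List using (List; length; []; _∷_; _++_; map)
open import Data.List.Membership.Propositional using (_∈_; find)
open import Data.List.Membership.Propositional.Properties using (∈-∃++; ∈-insert)
open import Data.List.Relation.Unary.All as All using (All; []; _∷_; lookup)
open import Data.List.Relation.Unary.All.Properties using (¬Any⇒All¬)
open import Data.List.Relation.Unary.Any as Any using (Any; here; there; any?)
open import Data.List.Relation.Unary.AllPairs using (AllPairs; []; _∷_)
open import Data.List.Relation.Binary.Permutation.Propositional using (_↭_)
open import Data.List.Relation.Binary.Permutation.Propositional.Properties using (shift; map⁺; ↭-length; All-resp-↭)
open import Data.Product using (Σ; ∃; _×_; _,_; proj₁; proj₂; swap)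
open import Data.Sum using (inj₁; inj₂)
open import Data.Bool using (if_then_else_)
open import Data.Empty using (⊥-elim)
open import Relation.Nullary using (¬_; Dec; yes; no; does)
open import Relation.Nullary.Decidable using (_⊎-dec_)
open import Relation.Binary.PropositionalEquality using (_≡_; refl; sym; trans; cong; subst; module ≡-Reasoning)
import Data.Fin.Properties as Fin

sumOver : {A : Set} → (A → ℕ) → List A → ℕ
sumOver f xs = sum (map f xs)

sumOver-zero : {A : Set} (f : A → ℕ) (xs : List A) →
  (∀ x → x ∈ xs → f x ≡ 0) → sumOver f xs ≡ 0
sumOver-zero f []       _  = refl
sumOver-zero f (x ∷ xs) f0 rewrite f0 x (here refl) = sumOver-zero f xs (λ y y∈ → f0 y (there y∈))

sumOver-+ : {A : Set} (f g : A → ℕ) (xs : List A) →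
  sumOver (λ x → f x + g x) xs ≡ sumOver f xs + sumOver g xs
sumOver-+ f g []       = refl
sumOver-+ f g (x ∷ xs) = begin
  (f x + g x) + sumOver (λ y → f y + g y) xs     ≡⟨ cong ((f x + g x) +_) (sumOver-+ f g xs) ⟩
  (f x + g x) + (sumOver f xs + sumOver g xs)    ≡⟨ interchange (f x) (g x) (sumOver f xs) (sumOver g xs) ⟩
  (f x + sumOver f xs) + (g x + sumOver g xs)    ∎
  where open ≡-Reasoning

sumOver-swap : {A B : Set} (f : A → B → ℕ) (xs : List A) (ys : List B) →
  sumOver (λ x → sumOver (f x) ys) xs ≡ sumOver (λ y → sumOver (λ x → f x y) xs) ys
sumOver-swap f []       ys = sym (sumOver-zero (λ _ → 0) ys (λ _ _ → refl))
sumOver-swap f (x ∷ xs) ys = begin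
  sumOver (f x) ys + sumOver (λ x' → sumOver (f x') ys) xs
    ≡⟨ cong (sumOver (f x) ys +_) (sumOver-swap f xs ys) ⟩
  sumOver (f x) ys + sumOver (λ y → sumOver (λ x' → f x' y) xs) ys
    ≡⟨ sym (sumOver-+ (f x) (λ y → sumOver (λ x' → f x' y) xs) ys) ⟩
  sumOver (λ y → f x y + sumOver (λ x' → f x' y) xs) ys
    ∎
  where open ≡-Reasoning

sumOver-↭ : {A : Set} (f : A → ℕ) {xs ys : List A} → xs ↭ ys → sumOver f xs ≡ sumOver f ys
sumOver-↭ f xs↭ys = sum-↭ (map⁺ f xs↭ys)

sumOver-≤-length : {A : Set} (f : A → ℕ) (xs : List A) → (∀ x → f x ≤ 1) → sumOver f xs ≤ length xs
sumOver-≤-length f []       _  = z≤n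
sumOver-≤-length f (x ∷ xs) f≤1 = +-mono-≤ (f≤1 x) (sumOver-≤-length f xs f≤1)

length-≤-sumOver : {A : Set} (f : A → ℕ) (xs : List A) → All (λ x → 1 ≤ f x) xs → length xs ≤ sumOver f xs
length-≤-sumOver f []       []          = z≤n
length-≤-sumOver f (x ∷ xs) (fx≥1 ∷ hs) = +-mono-≤ fx≥1 (length-≤-sumOver f xs hs)

term-≤-sumOver : {A : Set} (f : A → ℕ) {x : A} {xs : List A} → x ∈ xs → f x ≤ sumOver f xs
term-≤-sumOver f {xs = y ∷ ys} (here refl) = m≤m+n (f y) (sumOver f ys)
term-≤-sumOver f {xs = y ∷ ys} (there x∈)  = ≤-trans (term-≤-sumOver f x∈) (m≤n+m (sumOver f ys) (f y))

indicator : {A : Set} → Dec A → ℕ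
indicator d = if does d then 1 else 0

indicator-yes : {A : Set} (d : Dec A) → A → indicator d ≡ 1
indicator-yes (yes _) _ = refl
indicator-yes (no ¬a) a = ⊥-elim (¬a a)

indicator-no : {A : Set} (d : Dec A) → ¬ A → indicator d ≡ 0
indicator-no (yes a) ¬a = ⊥-elim (¬a a)
indicator-no (no _)  _  = refl

indicator-≤1 : {A : Set} (d : Dec A) → indicator d ≤ 1
indicator-≤1 (yes _) = s≤s z≤n
indicator-≤1 (no _)  = z≤n

All-remove : {A : Set} {P : A → Set} (xs : List A) {q : A} {ys : List A} →
  All P (xs ++ q ∷ ys) → All P (xs ++ ys)
All-remove xs {q} {ys} ps = All.tail (All-resp-↭ (shift q xs ys) ps)

AllPairs-remove : {A : Set} {R : A → A → Set} (xs : List A) {q : A} {ys : List A} →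
  AllPairs R (xs ++ q ∷ ys) → AllPairs R (xs ++ ys)
AllPairs-remove []       (_ ∷ rs) = rs
AllPairs-remove (x ∷ xs) (r ∷ rs) = All-remove xs r ∷ AllPairs-remove xs rs

module _ (G : Graph) where

  shared⇒Meet : ∀ v p q → _∈V_ G v p → _∈V_ G v q → Meet G p q
  shared⇒Meet v p q (inj₁ refl)        v∈q = here v∈q
  shared⇒Meet v p q (inj₂ (inj₁ refl)) v∈q = there (here v∈q)
  shared⇒Meet v p q (inj₂ (inj₂ refl)) v∈q = there (there (here v∈q))

  Meet⇒shared : ∀ p q → Meet G p q → ∃ λ v → _∈V_ G v p × _∈V_ G v q
  Meet⇒shared p q (here v∈q)                = a p , inj₁ refl , v∈q
  Meet⇒shared p q (there (here v∈q))        = b p , inj₂ (inj₁ refl) , v∈q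
  Meet⇒shared p q (there (there (here v∈q))) = c p , inj₂ (inj₂ refl) , v∈q

  Meet-sym : ∀ p q → Meet G p q → Meet G q p
  Meet-sym p q m with Meet⇒shared p q m
  ... | v , v∈p , v∈q = shared⇒Meet v q p v∈q v∈p

  Meet-refl : ∀ p → Meet G p p
  Meet-refl p = here (inj₁ refl)

  meet? : ∀ p q → Dec (Meet G p q)
  meet? p q = any? (λ v → (v Fin.≟ a q) ⊎-dec ((v Fin.≟ b q) ⊎-dec (v Fin.≟ c q))) _

  SameEdgeSet-refl : ∀ p → SameEdgeSet G p p
  SameEdgeSet-refl p = edges , edges
    where
    edges : All (λ e → Any (SameEdge G e) (E G p)) (E G p)
    edges = here (inj₁ (refl , refl)) ∷ there (here (inj₁ (refl , refl))) ∷ []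

  SameEdgeSet-sym : ∀ p q → SameEdgeSet G p q → SameEdgeSet G q p
  SameEdgeSet-sym p q = swap

  edge-endpoints : ∀ x {u w} → Any (SameEdge G (u , w)) (E G x) → _∈V_ G u x × _∈V_ G w x
  edge-endpoints x (here (inj₁ (refl , refl)))         = inj₁ refl , inj₂ (inj₁ refl)
  edge-endpoints x (here (inj₂ (refl , refl)))         = inj₂ (inj₁ refl) , inj₁ refl
  edge-endpoints x (there (here (inj₁ (refl , refl)))) = inj₂ (inj₁ refl) , inj₂ (inj₂ refl)
  edge-endpoints x (there (here (inj₂ (refl , refl)))) = inj₂ (inj₂ refl) , inj₂ (inj₁ refl)

  -- Paths with the same edge set have the same vertices (every vertex of a
  -- P₂ is an endpoint of one of its edges).
  SameEdgeSet⇒⊆V : ∀ x y {v} → SameEdgeSet G x y → _∈V_ G v y → _∈V_ G v x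
  SameEdgeSet⇒⊆V x y (_ , ab ∷ bc ∷ []) (inj₁ refl)        = proj₁ (edge-endpoints x ab)
  SameEdgeSet⇒⊆V x y (_ , ab ∷ bc ∷ []) (inj₂ (inj₁ refl)) = proj₂ (edge-endpoints x ab)
  SameEdgeSet⇒⊆V x y (_ , ab ∷ bc ∷ []) (inj₂ (inj₂ refl)) = proj₂ (edge-endpoints x bc)

  Meet-resp-SameEdgeSet : ∀ p q q' → SameEdgeSet G q' q → Meet G p q → Meet G p q'
  Meet-resp-SameEdgeSet p q q' s = Any.map (SameEdgeSet⇒⊆V q' q s)

  packing-Meet⇒≡ : ∀ {𝒫 x y} → IsPacking G 𝒫 → x ∈ 𝒫 → y ∈ 𝒫 → Meet G x y → x ≡ y
  packing-Meet⇒≡ _        (here refl) (here refl) _ = refl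
  packing-Meet⇒≡ (d ∷ _)  (here refl) (there y∈)  m = ⊥-elim (lookup d y∈ m)
  packing-Meet⇒≡ {x = x} {y} (d ∷ _) (there x∈) (here refl) m = ⊥-elim (lookup d x∈ (Meet-sym x y m))
  packing-Meet⇒≡ (_ ∷ ds) (there x∈)  (there y∈)  m = packing-Meet⇒≡ ds x∈ y∈ m

  reuses : P2 G → P2 G → ℕ
  reuses p' q = indicator (sameEdgeSet? G p' q)

  timesReused : List (P2 G) → P2 G → ℕ
  timesReused 𝒫 q = sumOver (λ p' → reuses p' q) 𝒫

  reuse-byColumns : ∀ 𝒫 𝒬 → reuse G 𝒫 𝒬 ≡ sumOver (timesReused 𝒫) 𝒬
  reuse-byColumns 𝒫 𝒬 = sumOver-swap reuses 𝒫 𝒬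

  -- A path p' is reused by at most one member of a packing: two members
  -- with the edges of p' would both contain V(p') and thus meet.
  reusedAtMostOnce : ∀ p' 𝒬 → IsPacking G 𝒬 → sumOver (reuses p') 𝒬 ≤ 1
  reusedAtMostOnce p' []       _        = z≤n
  reusedAtMostOnce p' (q ∷ 𝒬) (d ∷ ds) with sameEdgeSet? G p' q
  ... | no ¬s = +-mono-≤ (≤-reflexive (indicator-no (sameEdgeSet? G p' q) ¬s)) (reusedAtMostOnce p' 𝒬 ds)
  ... | yes s = +-mono-≤ (indicator-≤1 (sameEdgeSet? G p' q)) (≤-reflexive (sumOver-zero (reuses p') 𝒬 notReusedAgain))
    where
    notReusedAgain : ∀ q' → q' ∈ 𝒬 → reuses p' q' ≡ 0
    notReusedAgain q' q'∈ = indicator-no (sameEdgeSet? G p' q') λ s' →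
      lookup d q'∈ (Meet-resp-SameEdgeSet q p' q' (SameEdgeSet-sym p' q' s')
                     (Meet-resp-SameEdgeSet q q p' s (Meet-refl q)))

  -- Double counting: a packing larger than 𝒫 has a member reusing nothing.
  unreusedMember : ∀ 𝒫 𝒬 → IsPacking G 𝒬 → length 𝒫 < length 𝒬 →
    ∃ λ q → q ∈ 𝒬 × timesReused 𝒫 q ≡ 0
  unreusedMember 𝒫 𝒬 pk𝒬 |𝒫|<|𝒬| with any? (λ q → timesReused 𝒫 q ≟ 0) 𝒬
  ... | yes some = find some
  ... | no none  = ⊥-elim (<⇒≱ |𝒫|<|𝒬| allReused)
    where
    open ≤-Reasoning
    allReused : length 𝒬 ≤ length 𝒫
    allReused = begin
      length 𝒬                           ≤⟨ length-≤-sumOver (timesReused 𝒫) 𝒬 (All.map n≢0⇒n>0 (¬Any⇒All¬ 𝒬 none)) ⟩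
      sumOver (timesReused 𝒫) 𝒬          ≡⟨ reuse-byColumns 𝒫 𝒬 ⟨
      reuse G 𝒫 𝒬                        ≤⟨ sumOver-≤-length _ 𝒫 (λ p' → reusedAtMostOnce p' 𝒬 pk𝒬) ⟩
      length 𝒫                           ∎

  selfReused : ∀ {𝒫 p} → p ∈ 𝒫 → 1 ≤ timesReused 𝒫 p
  selfReused {𝒫} {p} p∈ = ≤-trans (≤-reflexive (sym (indicator-yes (sameEdgeSet? G p p) (SameEdgeSet-refl p))))
                                  (term-≤-sumOver (λ p' → reuses p' p) p∈)

  reuse-exchange : ∀ 𝒫 p xs q ys → p ∈ 𝒫 → timesReused 𝒫 q ≡ 0 →
    reuse G 𝒫 (xs ++ q ∷ ys) < reuse G 𝒫 (p ∷ xs ++ ys)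
  reuse-exchange 𝒫 p xs q ys p∈ unreused = begin-strict
    reuse G 𝒫 (xs ++ q ∷ ys)                               ≡⟨ reuse-byColumns 𝒫 (xs ++ q ∷ ys) ⟩
    sumOver (timesReused 𝒫) (xs ++ q ∷ ys)                 ≡⟨ sumOver-↭ (timesReused 𝒫) (shift q xs ys) ⟩
    timesReused 𝒫 q + sumOver (timesReused 𝒫) (xs ++ ys)   ≡⟨ cong (_+ sumOver (timesReused 𝒫) (xs ++ ys)) unreused ⟩
    sumOver (timesReused 𝒫) (xs ++ ys)                     <⟨ +-monoˡ-≤ (sumOver (timesReused 𝒫) (xs ++ ys)) (selfReused p∈) ⟩
    timesReused 𝒫 p + sumOver (timesReused 𝒫) (xs ++ ys)   ≡⟨ reuse-byColumns 𝒫 (p ∷ xs ++ ys) ⟨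
    reuse G 𝒫 (p ∷ xs ++ ys)                               ∎
    where open ≤-Reasoning

  -- Hence, in an optimal packing, p cannot be disjoint from all members but
  -- an unreused one: the exchange would be a better packing of equal size.
  optimal⇒noExchange : ∀ 𝒫 j p xs q ys → InQ1 G 𝒫 j (xs ++ q ∷ ys) → p ∈ 𝒫 →
    timesReused 𝒫 q ≡ 0 → ¬ All (VDisjoint G p) (xs ++ ys)
  optimal⇒noExchange 𝒫 j p xs q ys (pk , size , optimal) p∈ unreused disjoint =
    <⇒≱ (reuse-exchange 𝒫 p xs q ys p∈ unreused)
        (optimal (p ∷ xs ++ ys) (disjoint ∷ AllPairs-remove xs pk) (trans (sym (↭-length (shift q xs ys))) size))

  -- The member meeting p, if it is the only one, reuses no path of 𝒫:
  -- such a path would meet p, so it would be p, and p would be in 𝒬.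
  loneMeeter-unreused : ∀ 𝒫 𝒬 p q → IsPacking G 𝒫 → p ∈ 𝒫 → NotIn G p 𝒬 →
    q ∈ 𝒬 → Meet G p q → timesReused 𝒫 q ≡ 0
  loneMeeter-unreused 𝒫 𝒬 p q pk𝒫 p∈ p∉𝒬 q∈ m = sumOver-zero _ 𝒫 λ p' p'∈ →
    indicator-no (sameEdgeSet? G p' q) λ s →
      let p≡p' = packing-Meet⇒≡ pk𝒫 p∈ p'∈ (Meet-resp-SameEdgeSet p q p' s m)
      in p∉𝒬 (Any.map (λ q≡ → subst (SameEdgeSet G p) q≡ (subst (λ z → SameEdgeSet G z q) (sym p≡p') s)) q∈)

  data Meeters (p : P2 G) (𝒬 : List (P2 G)) : Set where
    twoMeeters : ∀ q₁ q₂ → q₁ ∈ 𝒬 → q₂ ∈ 𝒬 → ¬ q₁ ≡ q₂ → Meet G p q₁ → Meet G p q₂ → Meeters p 𝒬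
    noMeeter   : All (VDisjoint G p) 𝒬 → Meeters p 𝒬
    oneMeeter  : ∀ xs q ys → 𝒬 ≡ xs ++ q ∷ ys → All (VDisjoint G p) (xs ++ ys) → Meet G p q → Meeters p 𝒬

  classifyMeeters : ∀ p 𝒬 → IsPacking G 𝒬 → Meeters p 𝒬
  classifyMeeters p []       _        = noMeeter []
  classifyMeeters p (q ∷ 𝒬) (d ∷ ds) with classifyMeeters p 𝒬 ds | meet? p q
  ... | twoMeeters q₁ q₂ q₁∈ q₂∈ q₁≢q₂ m₁ m₂ | _ = twoMeeters q₁ q₂ (there q₁∈) (there q₂∈) q₁≢q₂ m₁ m₂
  ... | noMeeter disjoint | yes m = oneMeeter [] q 𝒬 refl disjoint m
  ... | noMeeter disjoint | no ¬m = noMeeter (¬m ∷ disjoint)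
  ... | oneMeeter xs q' ys refl disjoint m' | no ¬m = oneMeeter (q ∷ xs) q' ys refl (¬m ∷ disjoint) m'
  ... | oneMeeter xs q' ys refl disjoint m' | yes m =
    twoMeeters q q' (here refl) (there q'∈) q≢q' m m'
    where
    q'∈ : q' ∈ xs ++ q' ∷ ys
    q'∈ = ∈-insert xs
    q≢q' : ¬ q ≡ q'
    q≢q' q≡q' = lookup d q'∈ (subst (Meet G q) q≡q' (Meet-refl q))

corollary2 : (G : Graph) (j : ℕ) (𝒫 : List (P2 G)) →
    IsMaximalPacking G 𝒫 → length 𝒫 ≡ j →
    (Σ (List (P2 G)) λ 𝒬₀ → IsPacking G 𝒬₀ × (length 𝒬₀ ≡ suc j)) →
    (𝒬 : List (P2 G)) → InQ1 G 𝒫 j 𝒬 →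
    (p : P2 G) → p ∈ 𝒫 → NotIn G p 𝒬 →
    ∃ λ q₁ → ∃ λ q₂ → q₁ ∈ 𝒬 × q₂ ∈ 𝒬 × ¬ (q₁ ≡ q₂) × Meet G p q₁ × Meet G p q₂
corollary2 G j 𝒫 (pk𝒫 , _) |𝒫|≡j _ 𝒬 opt@(pk𝒬 , |𝒬|≡1+j , _) p p∈ p∉𝒬
  with classifyMeeters G p 𝒬 pk𝒬
... | twoMeeters q₁ q₂ q₁∈ q₂∈ q₁≢q₂ m₁ m₂ = q₁ , q₂ , q₁∈ , q₂∈ , q₁≢q₂ , m₁ , m₂
... | oneMeeter xs q ys refl disjoint m =
  ⊥-elim (optimal⇒noExchange G 𝒫 j p xs q ys opt p∈
           (loneMeeter-unreused G 𝒫 𝒬 p q pk𝒫 p∈ p∉𝒬 (∈-insert xs) m) disjoint)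
... | noMeeter disjoint
  with unreusedMember G 𝒫 𝒬 pk𝒬 (≤-reflexive (trans (cong suc |𝒫|≡j) (sym |𝒬|≡1+j)))
... | q , q∈ , unreused with ∈-∃++ q∈
...   | xs , ys , refl =
  ⊥-elim (optimal⇒noExchange G 𝒫 j p xs q ys opt p∈ unreused
           (All-remove xs disjoint))
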